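{- For every integer $n\ge 1$, with $a,b$ the two colors of $C_2$, $$\left|\Pi_n^{eq}\wr C_2(\{1^a1^a,1^a1^b,1^b1^a,1^b1^b\})\right|=\left|\Pi_n^{eq}\wr C_2(\{1^a2^a,1^a2^b,1^b2^a,1^b2^b\})\right|=2^n.$$
   Context: $\Pi_n\wr C_2$ is the set of colored set partitions of $[n]$ with colors $a,b$ (a set partition of $[n]$ plus a color for each element). For colors $\gamma,\delta$: a colored partition eq-contains $1^\gamma1^\delta$ if some block contains elements $x<y$ with $x$ colored $\gamma$ and $y$ colored $\delta$; it eq-contains $1^\gamma2^\delta$ if there are $x<y$ in different blocks with $x$ colored $\gamma$ and $y$ colored $\delta$. For a set $R$ of such patterns, $\Pi_n^{eq}\wr C_2(R)$ is the set of colored partitions eq-containing no pattern of $R$. -}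

module Defs where

open import Data.Nat using (ℕ; zero; suc)
open import Data.Bool using (Bool; true; false; _∧_; _∨_; not; if_then_else_)
open import Data.Fin using (Fin; toℕ)
open import Data.Nat using (_<ᵇ_)
open import Data.Bool.ListAction using (all; any)
open import Data.List using (List; []; _∷_; map; concatMap; filter; length; allFin; cartesianProduct)
open import Data.Vec using (Vec; []; _∷_; lookup)
open import Data.Product using (_×_; _,_)
open import Data.Bool.Properties using (T?)

data Color : Set where
  a b : Color

_==ᶜ_ : Color → Color → Bool
a ==ᶜ a = true
b ==ᶜ b = true
_ ==ᶜ _ = false

-- A set partition of [n] = {0,…,n-1} is encoded by its "same block" relation,
-- an n×n Boolean matrix R with R i j = true iff i and j lie in the same block;
-- the matrices that arise are exactly the equivalence relations on [n].
Matrix : ℕ → Set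
Matrix n = Vec (Vec Bool n) n

sameBlock : ∀ {n} → Matrix n → Fin n → Fin n → Bool
sameBlock R i j = lookup (lookup R i) j

forallFin : ∀ n → (Fin n → Bool) → Bool
forallFin n p = all p (allFin n)

existsFin : ∀ n → (Fin n → Bool) → Bool
existsFin n p = any p (allFin n)

_⇒ᵇ_ : Bool → Bool → Bool
x ⇒ᵇ y = not x ∨ y

isSetPartition : ∀ {n} → Matrix n → Bool
isSetPartition {n} R =
  forallFin n (λ i → sameBlock R i i) ∧
  forallFin n (λ i → forallFin n (λ j → sameBlock R i j ⇒ᵇ sameBlock R j i)) ∧
  forallFin n (λ i → forallFin n (λ j → forallFin n (λ k →
    (sameBlock R i j ∧ sameBlock R j k) ⇒ᵇ sameBlock R i k)))

allVecs : ∀ {A : Set} → List A → (n : ℕ) → List (Vec A n)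
allVecs xs zero = [] ∷ []
allVecs xs (suc n) = concatMap (λ x → map (x ∷_) (allVecs xs n)) xs

allMatrices : ∀ n → List (Matrix n)
allMatrices n = allVecs (allVecs (true ∷ false ∷ []) n) n

allColorings : ∀ n → List (Vec Color n)
allColorings n = allVecs (a ∷ b ∷ []) n

ColoredCandidate : ℕ → Set
ColoredCandidate n = Matrix n × Vec Color n

-- Patterns: same γ δ is 1^γ1^δ, diff γ δ is 1^γ2^δ.
data Pattern : Set where
  same diff : Color → Color → Pattern

eqContains : ∀ {n} → ColoredCandidate n → Pattern → Bool
eqContains {n} (R , c) (same γ δ) =
  existsFin n (λ x → existsFin n (λ y →
    (toℕ x <ᵇ toℕ y) ∧ sameBlock R x y ∧ (lookup c x ==ᶜ γ) ∧ (lookup c y ==ᶜ δ)))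
eqContains {n} (R , c) (diff γ δ) =
  existsFin n (λ x → existsFin n (λ y →
    (toℕ x <ᵇ toℕ y) ∧ not (sameBlock R x y) ∧ (lookup c x ==ᶜ γ) ∧ (lookup c y ==ᶜ δ)))

avoidsAll : ∀ {n} → ColoredCandidate n → List Pattern → Bool
avoidsAll P Rs = all (λ p → not (eqContains P p)) Rs

countAvoiders : ℕ → List Pattern → ℕ
countAvoiders n Rs =
  length (filter (λ P → T? (isSetPartition (Data.Product.proj₁ P) ∧ avoidsAll P Rs))
                 (cartesianProduct (allMatrices n) (allColorings n)))

module Submission where

-- Both counts equal 2^n because in each case exactly ONE set partition survives,
-- and it survives under every one of the 2^n colourings.
--
-- * Every element carries some colour, so avoiding all four colourings
--   1^γ1^δ (resp. 1^γ2^δ) says exactly that no two elements x < y lie in the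
--   same block (resp. in different blocks).  A set partition is an equivalence
--   relation, hence determined by its entries above the diagonal, so the only
--   avoider is the discrete partition (resp. the one-block partition).
-- * The candidates are enumerated as the product of all Boolean matrices with all
--   colourings.  A count over a product list factors into a product of counts;
--   hence the avoiders number (occurrences of that matrix) × (number of colourings).

open import Defs
open import Data.Nat using (ℕ; _≤_; _^_; suc; _+_; _*_; _<ᵇ_)
open import Data.Nat.Properties using (*-identityˡ; <ᵇ⇒<; <⇒<ᵇ)
open import Data.Bool using (Bool; true; false; _∧_; not; T)
open import Data.Bool.Properties using (T?; T-∧) renaming (_≟_ to _≟ᵇ_)
open import Data.List using (List; _∷_; []; map; concatMap; filter; length; allFin; cartesianProductWith; _++_)
open import Data.List.Properties using (filter-++; filter-≐; filter-all; filter-none; length-++; length-map)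
open import Data.List.Membership.Propositional using (_∈_)
import Data.List.Relation.Unary.All as All
open import Data.List.Relation.Unary.All.Properties using (all⁺; all⁻; tabulate⁺; tabulate⁻)
open import Data.List.Relation.Unary.Any using (here; there)
import Data.List.Relation.Unary.Any.Properties as Any
open import Data.Vec using (Vec; lookup; tabulate)
import Data.Vec as Vec
open import Data.Vec.Properties using (≡-dec; ∷-injective; lookup∘tabulate; tabulate∘lookup; tabulate-cong)
open import Data.Fin using (Fin; toℕ; _<_)
open import Data.Fin.Properties using (<-cmp; <-irrefl) renaming (_≟_ to _≟ᶠ_)
open import Data.Product using (_×_; _,_; proj₁; proj₂; ∃; uncurry)
open import Data.Unit using (tt)
open import Data.Empty using (⊥-elim)
open import Function using (_∘_; _⇔_; mk⇔; Equivalence)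
open import Relation.Binary.Definitions using (DecidableEquality; tri<; tri≈; tri>)
open import Relation.Binary.PropositionalEquality using (_≡_; refl; sym; trans; cong; cong₂; subst; module ≡-Reasoning)
open import Relation.Nullary using (¬_; yes; no; does)
open import Relation.Nullary.Decidable using (⌊_⌋; toWitness; fromWitness; decidable-stable)
open import Relation.Unary using (Pred; Decidable; _≐_)
open import Level using (0ℓ)

open Equivalence using (to; from)

private variable
  A B C : Set
  n : ℕ

count : {P : Pred A 0ℓ} → Decidable P → List A → ℕ
count P? xs = length (filter P? xs)

occurrences : DecidableEquality A → A → List A → ℕ
occurrences _≟_ x = count (λ y → y ≟ x)

module _ {P : Pred B 0ℓ} (P? : Decidable P) where

  count-++ : (xs ys : List B) → count P? (xs ++ ys) ≡ count P? xs + count P? ys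
  count-++ xs ys = trans (cong length (filter-++ P? xs ys)) (length-++ (filter P? xs) {filter P? ys})

  count-map : (f : A → B) (xs : List A) → count P? (map f xs) ≡ count (P? ∘ f) xs
  count-map f [] = refl
  count-map f (x ∷ xs) with does (P? (f x))
  ... | true  = cong suc (count-map f xs)
  ... | false = count-map f xs

  count-≐ : {Q : Pred B 0ℓ} (Q? : Decidable Q) → P ≐ Q → (xs : List B) → count P? xs ≡ count Q? xs
  count-≐ Q? P≐Q xs = cong length (filter-≐ P? Q? P≐Q xs)

  count-none : (∀ x → ¬ P x) → (xs : List B) → count P? xs ≡ 0
  count-none ¬P xs = cong length (filter-none P? {xs} (All.tabulate λ {x} _ → ¬P x))

  count-every : (∀ x → P x) → (xs : List B) → count P? xs ≡ length xs
  count-every every xs = cong length (filter-all P? {xs} (All.tabulate λ {x} _ → every x))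

count-product : {f : A → B → C} {P : Pred C 0ℓ} {Q : Pred A 0ℓ} {R : Pred B 0ℓ}
  (P? : Decidable P) (Q? : Decidable Q) (R? : Decidable R) →
  (∀ x y → P (f x y) ⇔ (Q x × R y)) →
  ∀ xs ys → count P? (cartesianProductWith f xs ys) ≡ count Q? xs * count R? ys
count-product P? Q? R? split [] ys = refl
count-product {f = f} P? Q? R? split (x ∷ xs) ys with Q? x
... | yes qx = begin
  count P? (map (f x) ys ++ rest)        ≡⟨ count-++ P? (map (f x) ys) rest ⟩
  count P? (map (f x) ys) + count P? rest ≡⟨ cong₂ _+_ row (count-product P? Q? R? split xs ys) ⟩
  count R? ys + count Q? xs * count R? ys ∎
  where
  open ≡-Reasoning
  rest = cartesianProductWith f xs ys
  row : count P? (map (f x) ys) ≡ count R? ys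
  row = trans (count-map P? (f x) ys)
    (count-≐ (P? ∘ f x) R? ((λ {y} p → proj₂ (to (split x y) p)) , (λ {y} r → from (split x y) (qx , r))) ys)
... | no ¬qx = begin
  count P? (map (f x) ys ++ rest)        ≡⟨ count-++ P? (map (f x) ys) rest ⟩
  count P? (map (f x) ys) + count P? rest ≡⟨ cong₂ _+_ row (count-product P? Q? R? split xs ys) ⟩
  0 + count Q? xs * count R? ys          ∎
  where
  open ≡-Reasoning
  rest = cartesianProductWith f xs ys
  row : count P? (map (f x) ys) ≡ 0
  row = trans (count-map P? (f x) ys) (count-none (P? ∘ f x) (λ y p → ¬qx (proj₁ (to (split x y) p))) ys)

length-cartesianProductWith : (f : A → B → C) (xs : List A) (ys : List B) →
  length (cartesianProductWith f xs ys) ≡ length xs * length ys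
length-cartesianProductWith f [] ys = refl
length-cartesianProductWith f (x ∷ xs) ys =
  trans (length-++ (map (f x) ys) {cartesianProductWith f xs ys})
        (cong₂ _+_ (length-map (f x) ys) (length-cartesianProductWith f xs ys))

concatMap-row : (f : A → B → C) (xs : List A) (ys : List B) →
  concatMap (λ x → map (f x) ys) xs ≡ cartesianProductWith f xs ys
concatMap-row f [] ys = refl
concatMap-row f (x ∷ xs) ys = cong (map (f x) ys ++_) (concatMap-row f xs ys)

allVecs-suc : (L : List A) (n : ℕ) → allVecs L (suc n) ≡ cartesianProductWith Vec._∷_ L (allVecs L n)
allVecs-suc L n = concatMap-row Vec._∷_ L (allVecs L n)

length-allVecs : (L : List A) (n : ℕ) → length (allVecs L n) ≡ length L ^ n
length-allVecs L 0 = refl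
length-allVecs L (suc n) = begin
  length (allVecs L (suc n))                         ≡⟨ cong length (allVecs-suc L n) ⟩
  length (cartesianProductWith Vec._∷_ L (allVecs L n)) ≡⟨ length-cartesianProductWith Vec._∷_ L (allVecs L n) ⟩
  length L * length (allVecs L n)                    ≡⟨ cong (length L *_) (length-allVecs L n) ⟩
  length L * length L ^ n                            ∎
  where open ≡-Reasoning

-- If every letter occurs exactly once in L, every vector occurs exactly once in
-- allVecs L n: the occurrences of x ∷ v factor as (occurrences of x) × (of v).
allVecs-once : (_≟_ : DecidableEquality A) (L : List A) → (∀ x → occurrences _≟_ x L ≡ 1) →
  (n : ℕ) (v : Vec A n) → occurrences (≡-dec _≟_) v (allVecs L n) ≡ 1
allVecs-once _≟_ L once 0 Vec.[] = refl
allVecs-once _≟_ L once (suc n) (x Vec.∷ v) = begin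
  occurrences (≡-dec _≟_) (x Vec.∷ v) (allVecs L (suc n))
    ≡⟨ cong (occurrences (≡-dec _≟_) (x Vec.∷ v)) (allVecs-suc L n) ⟩
  occurrences (≡-dec _≟_) (x Vec.∷ v) (cartesianProductWith Vec._∷_ L (allVecs L n))
    ≡⟨ count-product (λ w → ≡-dec _≟_ w (x Vec.∷ v)) (λ y → y ≟ x) (λ w → ≡-dec _≟_ w v)
                     (λ y w → mk⇔ ∷-injective (uncurry (cong₂ Vec._∷_))) L (allVecs L n) ⟩
  occurrences _≟_ x L * occurrences (≡-dec _≟_) v (allVecs L n)
    ≡⟨ cong₂ _*_ (once x) (allVecs-once _≟_ L once n v) ⟩
  1 ∎
  where open ≡-Reasoning

allMatrices-once : (M : Matrix n) → occurrences (≡-dec (≡-dec _≟ᵇ_)) M (allMatrices n) ≡ 1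
allMatrices-once {n} M =
  allVecs-once (≡-dec _≟ᵇ_) (allVecs bools n) (allVecs-once _≟ᵇ_ bools bool-once n) n M
  where
  bools : List Bool
  bools = true ∷ false ∷ []
  bool-once : ∀ x → occurrences _≟ᵇ_ x bools ≡ 1
  bool-once true  = refl
  bool-once false = refl

T-not⁺ : ∀ {x} → ¬ T x → T (not x)
T-not⁺ {true}  ¬x = ¬x tt
T-not⁺ {false} _  = tt

T-not⁻ : ∀ {x} → T (not x) → ¬ T x
T-not⁻ {true} ()

T-⇒ᵇ⁺ : ∀ {x y} → (T x → T y) → T (x ⇒ᵇ y)
T-⇒ᵇ⁺ {true}  x→y = x→y tt
T-⇒ᵇ⁺ {false} _   = tt

T-⇒ᵇ⁻ : ∀ {x y} → T (x ⇒ᵇ y) → T x → T y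
T-⇒ᵇ⁻ {true} x⇒y _ = x⇒y

T-ext : ∀ {x y} → (T x → T y) → (T y → T x) → x ≡ y
T-ext {true}  {true}  _ _ = refl
T-ext {true}  {false} x→y _ = ⊥-elim (x→y tt)
T-ext {false} {true}  _ y→x = ⊥-elim (y→x tt)
T-ext {false} {false} _ _ = refl

forallFin⁺ : (p : Fin n → Bool) → (∀ i → T (p i)) → T (forallFin n p)
forallFin⁺ {n} p every = all⁻ p (tabulate⁺ every)

forallFin⁻ : (p : Fin n → Bool) → T (forallFin n p) → ∀ i → T (p i)
forallFin⁻ {n} p holds = tabulate⁻ (all⁺ p (allFin n) holds)

existsFin⁺ : (p : Fin n → Bool) (i : Fin n) → T (p i) → T (existsFin n p)
existsFin⁺ p i pi = Any.any⁺ p (Any.tabulate⁺ i pi)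

existsFin⁻ : (p : Fin n → Bool) → T (existsFin n p) → ∃ (λ i → T (p i))
existsFin⁻ {n} p holds = Any.tabulate⁻ (Any.any⁻ p (allFin n) holds)

record IsEquivalenceMatrix (R : Matrix n) : Set where
  field
    reflexive  : ∀ i → T (sameBlock R i i)
    symmetric  : ∀ {i j} → T (sameBlock R i j) → T (sameBlock R j i)
    transitive : ∀ {i j k} → T (sameBlock R i j) → T (sameBlock R j k) → T (sameBlock R i k)

open IsEquivalenceMatrix

reflexiveᵇ symmetricᵇ transitiveᵇ : Matrix n → Bool
reflexiveᵇ  {n} R = forallFin n (λ i → sameBlock R i i)
symmetricᵇ  {n} R = forallFin n (λ i → forallFin n (λ j → sameBlock R i j ⇒ᵇ sameBlock R j i))
transitiveᵇ {n} R = forallFin n (λ i → forallFin n (λ j → forallFin n (λ k →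
  (sameBlock R i j ∧ sameBlock R j k) ⇒ᵇ sameBlock R i k)))

setPartition-split : (R : Matrix n) →
  T (isSetPartition R) ⇔ (T (reflexiveᵇ R) × T (symmetricᵇ R) × T (transitiveᵇ R))
setPartition-split R = mk⇔
  (λ holds → let (r , st) = to (T-∧ {reflexiveᵇ R}) holds in r , to (T-∧ {symmetricᵇ R}) st)
  (λ (r , s , t) → from (T-∧ {reflexiveᵇ R}) (r , from (T-∧ {symmetricᵇ R}) (s , t)))

setPartition⁻ : (R : Matrix n) → T (isSetPartition R) → IsEquivalenceMatrix R
setPartition⁻ {n} R holds = record
  { reflexive  = forallFin⁻ (λ i → s i i) refl-holds
  ; symmetric  = λ {i} {j} → T-⇒ᵇ⁻ (forallFin⁻ (symmetricAt i) (forallFin⁻ _ sym-holds i) j)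
  ; transitive = λ {i} {j} {k} Rij Rjk →
      T-⇒ᵇ⁻ (forallFin⁻ (transitiveAt i j) (forallFin⁻ (λ j → forallFin n (transitiveAt i j))
               (forallFin⁻ _ trans-holds i) j) k)
            (from (T-∧ {s i j}) (Rij , Rjk))
  }
  where
  s = sameBlock R
  symmetricAt : Fin n → Fin n → Bool
  symmetricAt i j = s i j ⇒ᵇ s j i
  transitiveAt : Fin n → Fin n → Fin n → Bool
  transitiveAt i j k = (s i j ∧ s j k) ⇒ᵇ s i k
  refl-holds : T (reflexiveᵇ R)
  refl-holds = proj₁ (to (setPartition-split R) holds)
  sym-holds : T (forallFin n (λ i → forallFin n (symmetricAt i)))
  sym-holds = proj₁ (proj₂ (to (setPartition-split R) holds))
  trans-holds : T (forallFin n (λ i → forallFin n (λ j → forallFin n (transitiveAt i j))))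
  trans-holds = proj₂ (proj₂ (to (setPartition-split R) holds))

setPartition⁺ : (R : Matrix n) → IsEquivalenceMatrix R → T (isSetPartition R)
setPartition⁺ {n} R eqv = from (setPartition-split R) (refl-holds , sym-holds , trans-holds)
  where
  s = sameBlock R
  refl-holds : T (reflexiveᵇ R)
  refl-holds = forallFin⁺ (λ i → s i i) (reflexive eqv)
  sym-holds : T (symmetricᵇ R)
  sym-holds = forallFin⁺ _ λ i → forallFin⁺ (λ j → s i j ⇒ᵇ s j i) λ j → T-⇒ᵇ⁺ (symmetric eqv)
  trans-holds : T (transitiveᵇ R)
  trans-holds = forallFin⁺ _ λ i → forallFin⁺ _ λ j → forallFin⁺ (λ k → (s i j ∧ s j k) ⇒ᵇ s i k) λ k →
    T-⇒ᵇ⁺ λ Rijk → transitive eqv (proj₁ (to (T-∧ {s i j}) Rijk)) (proj₂ (to (T-∧ {s i j}) Rijk))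

fromRelation : (Fin n → Fin n → Bool) → Matrix n
fromRelation f = tabulate (λ i → tabulate (f i))

sameBlock-fromRelation : (f : Fin n → Fin n → Bool) (i j : Fin n) → sameBlock (fromRelation f) i j ≡ f i j
sameBlock-fromRelation f i j =
  trans (cong (λ row → lookup row j) (lookup∘tabulate (λ i → tabulate (f i)) i)) (lookup∘tabulate (f i) j)

lookup-ext : (u v : Vec A n) → (∀ i → lookup u i ≡ lookup v i) → u ≡ v
lookup-ext u v same-entries =
  trans (sym (tabulate∘lookup u)) (trans (tabulate-cong same-entries) (tabulate∘lookup v))

matrix-ext : (R S : Matrix n) → (∀ i j → sameBlock R i j ≡ sameBlock S i j) → R ≡ S
matrix-ext R S same-entries = lookup-ext R S (λ i → lookup-ext (lookup R i) (lookup S i) (same-entries i))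

symmetric-≡ : {R : Matrix n} → IsEquivalenceMatrix R → ∀ i j → sameBlock R i j ≡ sameBlock R j i
symmetric-≡ eqv i j = T-ext (symmetric eqv) (symmetric eqv)

determinedAbove : {R S : Matrix n} → IsEquivalenceMatrix R → IsEquivalenceMatrix S →
  (∀ {i j} → i < j → sameBlock R i j ≡ sameBlock S i j) → R ≡ S
determinedAbove {R = R} {S} eqvR eqvS above = matrix-ext R S entry
  where
  entry : ∀ i j → sameBlock R i j ≡ sameBlock S i j
  entry i j with <-cmp i j
  ... | tri< i<j _ _ = above i<j
  ... | tri≈ _ refl _ = T-ext (λ _ → reflexive eqvS i) (λ _ → reflexive eqvR i)
  ... | tri> _ _ j<i = begin
    sameBlock R i j ≡⟨ symmetric-≡ eqvR i j ⟩
    sameBlock R j i ≡⟨ above j<i ⟩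
    sameBlock S j i ≡⟨ symmetric-≡ eqvS j i ⟩
    sameBlock S i j ∎
    where open ≡-Reasoning

data Shape : Set where
  sameBlocks differentBlocks : Shape

shaped : Shape → Color → Color → Pattern
shaped sameBlocks      = same
shaped differentBlocks = diff

everyColouring : Shape → List Pattern
everyColouring s = shaped s a a ∷ shaped s a b ∷ shaped s b a ∷ shaped s b b ∷ []

linked : Shape → Matrix n → Fin n → Fin n → Bool
linked sameBlocks      R x y = sameBlock R x y
linked differentBlocks R x y = not (sameBlock R x y)

forced : Shape → Bool
forced sameBlocks      = false
forced differentBlocks = true

unlinked⇒forced : (s : Shape) (R : Matrix n) (x y : Fin n) → ¬ T (linked s R x y) → sameBlock R x y ≡ forced s
unlinked⇒forced sameBlocks      R x y ¬link = T-ext (λ link → ⊥-elim (¬link link)) λ ()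
unlinked⇒forced differentBlocks R x y ¬link =
  T-ext (λ _ → tt) (λ _ → decidable-stable (T? (sameBlock R x y)) (¬link ∘ T-not⁺))

forced⇒unlinked : (s : Shape) (R : Matrix n) (x y : Fin n) → sameBlock R x y ≡ forced s → ¬ T (linked s R x y)
forced⇒unlinked sameBlocks      R x y eq link = subst T eq link
forced⇒unlinked differentBlocks R x y eq link = subst (T ∘ not) eq link

canonical : Shape → Matrix n
canonical sameBlocks      = fromRelation (λ i j → ⌊ i ≟ᶠ j ⌋)
canonical differentBlocks = fromRelation (λ _ _ → true)

canonical-isEquivalence : (s : Shape) → IsEquivalenceMatrix (canonical {n} s)
canonical-isEquivalence {n} sameBlocks = record
  { reflexive  = λ i → same-block i i refl
  ; symmetric  = λ {i} {j} Rij → same-block j i (sym (block-same i j Rij))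
  ; transitive = λ {i} {j} {k} Rij Rjk → same-block i k (trans (block-same i j Rij) (block-same j k Rjk))
  }
  where
  block-same : ∀ (i j : Fin n) → T (sameBlock (canonical sameBlocks) i j) → i ≡ j
  block-same i j Rij = toWitness {a? = i ≟ᶠ j} (subst T (sameBlock-fromRelation _ i j) Rij)
  same-block : ∀ (i j : Fin n) → i ≡ j → T (sameBlock (canonical sameBlocks) i j)
  same-block i j i≡j = subst T (sym (sameBlock-fromRelation _ i j)) (fromWitness {a? = i ≟ᶠ j} i≡j)
canonical-isEquivalence {n} differentBlocks = record
  { reflexive  = λ i → one-block i i
  ; symmetric  = λ {i} {j} _ → one-block j i
  ; transitive = λ {i} {j} {k} _ _ → one-block i k
  }
  where
  one-block : ∀ (i j : Fin n) → T (sameBlock (canonical differentBlocks) i j)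
  one-block i j = subst T (sym (sameBlock-fromRelation _ i j)) tt

canonical-above : (s : Shape) {i j : Fin n} → i < j → sameBlock (canonical s) i j ≡ forced s
canonical-above sameBlocks {i} {j} i<j with i ≟ᶠ j | sameBlock-fromRelation (λ i j → ⌊ i ≟ᶠ j ⌋) i j
... | yes refl | _          = ⊥-elim (<-irrefl refl i<j)
... | no _     | entry≡false = entry≡false
canonical-above differentBlocks {i} {j} _ = sameBlock-fromRelation _ i j

realises : Shape → ColoredCandidate n → Color → Color → Fin n → Fin n → Bool
realises s (R , c) γ δ x y = (toℕ x <ᵇ toℕ y) ∧ linked s R x y ∧ (lookup c x ==ᶜ γ) ∧ (lookup c y ==ᶜ δ)

eqContains-shaped : (s : Shape) (P : ColoredCandidate n) (γ δ : Color) →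
  eqContains P (shaped s γ δ) ≡ existsFin n (λ x → existsFin n (realises s P γ δ x))
eqContains-shaped sameBlocks      (R , c) γ δ = refl
eqContains-shaped differentBlocks (R , c) γ δ = refl

==ᶜ-refl : (γ : Color) → T (γ ==ᶜ γ)
==ᶜ-refl a = tt
==ᶜ-refl b = tt

linked⇒contains : (s : Shape) (R : Matrix n) (c : Vec Color n) {x y : Fin n} → x < y →
  T (linked s R x y) → T (eqContains (R , c) (shaped s (lookup c x) (lookup c y)))
linked⇒contains {n} s R c {x} {y} x<y link =
  subst T (sym (eqContains-shaped s (R , c) (lookup c x) (lookup c y)))
    (existsFin⁺ _ x (existsFin⁺ (realises s (R , c) (lookup c x) (lookup c y) x) y
      (from (T-∧ {toℕ x <ᵇ toℕ y}) (<⇒<ᵇ x<y ,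
        from (T-∧ {linked s R x y}) (link ,
          from (T-∧ {lookup c x ==ᶜ lookup c x}) (==ᶜ-refl (lookup c x) , ==ᶜ-refl (lookup c y)))))))

contains⇒linked : (s : Shape) (R : Matrix n) (c : Vec Color n) (γ δ : Color) →
  T (eqContains (R , c) (shaped s γ δ)) → ∃ λ x → ∃ λ y → x < y × T (linked s R x y)
contains⇒linked {n} s R c γ δ contains =
  let (x , holds-x) = existsFin⁻ _ (subst T (eqContains-shaped s (R , c) γ δ) contains)
      (y , holds)   = existsFin⁻ (realises s (R , c) γ δ x) holds-x
      (x<ᵇy , rest) = to (T-∧ {toℕ x <ᵇ toℕ y}) holds
  in x , y , <ᵇ⇒< (toℕ x) (toℕ y) x<ᵇy , proj₁ (to (T-∧ {linked s R x y}) rest)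

shaped∈everyColouring : (s : Shape) (γ δ : Color) → shaped s γ δ ∈ everyColouring s
shaped∈everyColouring s a a = here refl
shaped∈everyColouring s a b = there (here refl)
shaped∈everyColouring s b a = there (there (here refl))
shaped∈everyColouring s b b = there (there (there (here refl)))

-- Since every element carries some colour, avoiding all four colourings of a
-- shape says exactly that no pair x < y is linked.
avoidsEveryColouring⁻ : (s : Shape) (R : Matrix n) (c : Vec Color n) →
  T (avoidsAll (R , c) (everyColouring s)) → ∀ {x y} → x < y → ¬ T (linked s R x y)
avoidsEveryColouring⁻ s R c avoids {x} {y} x<y link =
  T-not⁻ (All.lookup (all⁺ avoided (everyColouring s) avoids) (shaped∈everyColouring s (lookup c x) (lookup c y)))
         (linked⇒contains s R c x<y link)
  where
  avoided : Pattern → Bool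
  avoided p = not (eqContains (R , c) p)

avoidsEveryColouring⁺ : (s : Shape) (R : Matrix n) (c : Vec Color n) →
  (∀ {x y} → x < y → ¬ T (linked s R x y)) → T (avoidsAll (R , c) (everyColouring s))
avoidsEveryColouring⁺ s R c unlinked =
  all⁻ avoided {everyColouring s} (avoids a a All.∷ avoids a b All.∷ avoids b a All.∷ avoids b b All.∷ All.[])
  where
  avoided : Pattern → Bool
  avoided p = not (eqContains (R , c) p)
  avoids : (γ δ : Color) → T (avoided (shaped s γ δ))
  avoids γ δ = T-not⁺ λ contains →
    let (x , y , x<y , link) = contains⇒linked s R c γ δ contains in unlinked x<y link

avoider⇔canonical : (s : Shape) (R : Matrix n) (c : Vec Color n) →
  T (isSetPartition R ∧ avoidsAll (R , c) (everyColouring s)) ⇔ R ≡ canonical s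
avoider⇔canonical s R c = mk⇔ avoider⇒canonical canonical⇒avoider
  where
  avoider⇒canonical : T (isSetPartition R ∧ avoidsAll (R , c) (everyColouring s)) → R ≡ canonical s
  avoider⇒canonical holds =
    let (partition , avoids) = to (T-∧ {isSetPartition R}) holds
    in determinedAbove (setPartition⁻ R partition) (canonical-isEquivalence s) λ {x} {y} x<y →
         trans (unlinked⇒forced s R x y (avoidsEveryColouring⁻ s R c avoids x<y)) (sym (canonical-above s x<y))
  canonical⇒avoider : R ≡ canonical s → T (isSetPartition R ∧ avoidsAll (R , c) (everyColouring s))
  canonical⇒avoider refl = from (T-∧ {isSetPartition R})
    ( setPartition⁺ R (canonical-isEquivalence s)
    , avoidsEveryColouring⁺ s R c λ {x} {y} x<y → forced⇒unlinked s R x y (canonical-above s x<y))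

countAvoiders-single : (n : ℕ) (Rs : List Pattern) (M₀ : Matrix n) →
  (∀ R c → T (isSetPartition R ∧ avoidsAll (R , c) Rs) ⇔ R ≡ M₀) → countAvoiders n Rs ≡ 2 ^ n
countAvoiders-single n Rs M₀ avoider⇔M₀ = begin
  countAvoiders n Rs
    ≡⟨ count-product (λ P → T? (isSetPartition (proj₁ P) ∧ avoidsAll P Rs)) (λ R → ≡-dec (≡-dec _≟ᵇ_) R M₀)
                     (λ (_ : Vec Color n) → yes tt) (λ R c → mk⇔ (λ avoids → to (avoider⇔M₀ R c) avoids , tt)
                                                                  (from (avoider⇔M₀ R c) ∘ proj₁))
                     (allMatrices n) (allColorings n) ⟩
  occurrences (≡-dec (≡-dec _≟ᵇ_)) M₀ (allMatrices n) * count (λ _ → yes tt) (allColorings n)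
    ≡⟨ cong₂ _*_ (allMatrices-once M₀) (count-every (λ _ → yes tt) (λ _ → tt) (allColorings n)) ⟩
  1 * length (allColorings n)
    ≡⟨ *-identityˡ _ ⟩
  length (allColorings n)
    ≡⟨ length-allVecs (a ∷ b ∷ []) n ⟩
  2 ^ n ∎
  where open ≡-Reasoning

theorem3p2 : (n : ℕ) → 1 ≤ n →
    (countAvoiders n (same a a ∷ same a b ∷ same b a ∷ same b b ∷ []) ≡ 2 ^ n)
    × (countAvoiders n (diff a a ∷ diff a b ∷ diff b a ∷ diff b b ∷ []) ≡ 2 ^ n)
theorem3p2 n _ =
    countAvoiders-single n (everyColouring sameBlocks) (canonical sameBlocks) (avoider⇔canonical sameBlocks)
  , countAvoiders-single n (everyColouring differentBlocks) (canonical differentBlocks) (avoider⇔canonical differentBlocks)
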